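{- Let $I$ be a finite index set, let $\sigma$ be a counter $I$-signature, and let $\varphi$ be a global quantifier-free first-order $(I,\sigma)$-sentence. Then for every graph $G=L\cup R$ (with $L,R$ subgraphs of $G$) and every $G$-interpretation $\mathcal{I}$ of $\sigma$, the relation $\equiv_{(L,R)}$ has $\exp(O(|V(L\cap R)|))$ equivalence classes, i.e., at most $C\cdot c^{|V(L\cap R)|}$ classes for constants $C,c$ depending only on $I$, $\sigma$ and $\varphi$.
   Context: An $I$-tuple of subsets of $S$ is $A_I=\{A_i:i\in I\}$ with $A_i\subseteq S$; $A_I\cup B_I$ is componentwise. A term is a variable or a composition of unary function symbols applied to a variable. A counter $I$-signature $\sigma$ consists of unary predicate symbols, unary function symbols, and linearly ordered counter symbols, each with a trigger $(f,\theta)$ where $f$ is a unary function symbol of $\sigma$ and $\theta$ is an $x$-local $\gamma$-dominated first-order $(I,\sigma)$-formula. A first-order $(I,\sigma)$-formula is a first-order formula over vertices (equality, Boolean connectives, no adjacency predicate) using predicates $X_i$ ($i\in I$), symbols of $\sigma$ and atomic formulas $\gamma(t)\ge m$ ($t$ a term, $m$ a positive integer); $\gamma$-dominated: all counters in it are strictly smaller than $\gamma$; $x$-local: quantifier-free, no function symbols, only variable $x$. A global formula may also use $\#\theta\ge m$ ($\theta$ $x$-local), true iff at least $m$ vertices satisfy $\theta$. A $G$-interpretation $\mathcal{I}$ assigns a subset of $V(G)$ to each predicate symbol and to each function symbol a function $f_{\mathcal{I}}$ with $f_{\mathcal{I}}(v)=v$ or $f_{\mathcal{I}}(v)$ adjacent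 to $v$. Given $A_I$ (interpreting $X_i$ as $A_i$), counters are evaluated along the order: for $\gamma$ with trigger $(f,\theta)$, $\gamma(v)$ is the number of $u\ne v$ with $f_{\mathcal{I}}(u)=v$ and $\theta(u)$ true; $G,\mathcal{I},A_I\models\varphi$ denotes satisfaction. For $I$-tuples $A_I,A'_I$ of subsets of $V(L)$, $A_I\equiv_{(L,R)}A'_I$ means that for every $I$-tuple $B_I$ of subsets of $V(R)\setminus V(L)$, $G,\mathcal{I},A_I\cup B_I\models\varphi$ iff $G,\mathcal{I},A'_I\cup B_I\models\varphi$. -}

module Defs where

open import Data.Nat using (ℕ; zero; suc; _≤_; _*_; _^_; _≤ᵇ_)
open import Data.Bool using (Bool; true; false; _∧_; _∨_; not; if_then_else_)
open import Data.Fin using (Fin; zero; suc; _≟_)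
open import Data.List using (List; []; _∷_; map; allFin; foldr)
open import Data.Nat.ListAction using (sum)
open import Data.Product using (Σ; ∃; _×_; _,_)
open import Data.Sum using (_⊎_)
open import Relation.Binary.PropositionalEquality using (_≡_)
open import Relation.Nullary.Decidable using (⌊_⌋)

VSet : ℕ → Set
VSet n = Fin n → Bool

_=ᶠ_ : ∀ {n} → Fin n → Fin n → Bool
u =ᶠ v = ⌊ u ≟ v ⌋

count : ∀ {n} → (Fin n → Bool) → ℕ
count {n} P = sum (map (λ u → if P u then 1 else 0) (allFin n))

record Graph (n : ℕ) : Set where
  field
    adj     : Fin n → Fin n → Bool
    adj-sym : ∀ u v → adj u v ≡ adj v u
    adj-irr : ∀ v → adj v v ≡ false
open Graph public

record Subgraph {n : ℕ} (G : Graph n) : Set where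
  field
    vert      : VSet n
    edge      : Fin n → Fin n → Bool
    edge-sym  : ∀ u v → edge u v ≡ edge v u
    edge⊆adj  : ∀ u v → edge u v ≡ true → adj G u v ≡ true
    edge-ends : ∀ u v → edge u v ≡ true → (vert u ≡ true) × (vert v ≡ true)
open Subgraph public

IsUnion : ∀ {n} (G : Graph n) (L R : Subgraph G) → Set
IsUnion {n} G L R =
  (∀ (v : Fin n) → (vert L v ∨ vert R v) ≡ true) ×
  (∀ (u v : Fin n) → adj G u v ≡ (edge L u v ∨ edge R u v))

-- Syntax.  I = Fin k.  A counter signature has `p` unary predicate symbols
-- (Fin p), `q` unary function symbols (Fin q) and `r` counters.

-- x-local formulas (quantifier-free, no function symbols, only variable x)
-- over I = Fin k, p predicate symbols, and counters from Fin c.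
-- (x = x is expressed by ⊤.)
data LF (k p c : ℕ) : Set where
  ⊤ᴸ   : LF k p c
  ¬ᴸ   : LF k p c → LF k p c
  _∧ᴸ_ : LF k p c → LF k p c → LF k p c
  _∨ᴸ_ : LF k p c → LF k p c → LF k p c
  Xᴸ   : Fin k → LF k p c
  Pᴸ   : Fin p → LF k p c
  γᴸ   : Fin c → (m : ℕ) → 1 ≤ m → LF k p c

-- Linearly ordered counters as a telescope: each new counter has a trigger
-- (f , θ) where θ is x-local and may only use the previously introduced
-- counters (γ-dominated).  In `Counters k p q j`, counter `zero` is the
-- last (largest) one, `suc i` refers to the earlier counters.
data Counters (k p q : ℕ) : ℕ → Set where
  []  : Counters k p q 0
  _▷_ : ∀ {j} → Counters k p q j → Fin q × LF k p j → Counters k p q (suc j)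

record Sig (k : ℕ) : Set where
  field
    npred    : ℕ
    nfun     : ℕ
    ncnt     : ℕ
    counters : Counters k npred nfun ncnt
open Sig public

-- terms: a variable (from Fin v) with a composition of function symbols
Term : (q v : ℕ) → Set
Term q v = Fin v × List (Fin q)

data GF (k p q c v : ℕ) : Set where
  ⊤ᴳ   : GF k p q c v
  ¬ᴳ   : GF k p q c v → GF k p q c v
  _∧ᴳ_ : GF k p q c v → GF k p q c v → GF k p q c v
  _∨ᴳ_ : GF k p q c v → GF k p q c v → GF k p q c v
  _≐_  : Term q v → Term q v → GF k p q c v
  Xᴳ   : Fin k → Term q v → GF k p q c v
  Pᴳ   : Fin p → Term q v → GF k p q c v
  γᴳ   : Fin c → Term q v → (m : ℕ) → 1 ≤ m → GF k p q c v
  #ᴳ   : LF k p c → ℕ → GF k p q c v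

Sentence : ∀ {k} → Sig k → Set
Sentence {k} σ = GF k (npred σ) (nfun σ) (ncnt σ) 0

Tuple : ℕ → ℕ → Set
Tuple k n = Fin k → VSet n

_∪ᵀ_ : ∀ {k n} → Tuple k n → Tuple k n → Tuple k n
(A ∪ᵀ B) i v = A i v ∨ B i v

record Interp {n : ℕ} (G : Graph n) {k : ℕ} (σ : Sig k) : Set where
  field
    pred   : Fin (npred σ) → VSet n
    fun    : Fin (nfun σ) → Fin n → Fin n
    fun-ok : ∀ f v → (fun f v ≡ v) ⊎ (adj G v (fun f v) ≡ true)
open Interp public

evalLF : ∀ {k p c n} → Tuple k n → (Fin p → VSet n) → (Fin c → Fin n → ℕ) →
         LF k p c → Fin n → Bool
evalLF A P γ ⊤ᴸ x = true
evalLF A P γ (¬ᴸ θ) x = not (evalLF A P γ θ x)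
evalLF A P γ (θ ∧ᴸ θ') x = evalLF A P γ θ x ∧ evalLF A P γ θ' x
evalLF A P γ (θ ∨ᴸ θ') x = evalLF A P γ θ x ∨ evalLF A P γ θ' x
evalLF A P γ (Xᴸ i) x = A i x
evalLF A P γ (Pᴸ a) x = P a x
evalLF A P γ (γᴸ g m _) x = m ≤ᵇ γ g x

evalCounters : ∀ {k p q c n} → Tuple k n → (Fin p → VSet n) → (Fin q → Fin n → Fin n) →
               Counters k p q c → Fin c → Fin n → ℕ
evalCounters A P F [] ()
evalCounters A P F (cs ▷ (f , θ)) zero v =
  count (λ u → not (u =ᶠ v) ∧ ((F f u =ᶠ v) ∧ evalLF A P (evalCounters A P F cs) θ u))
evalCounters A P F (cs ▷ _) (suc i) v = evalCounters A P F cs i v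

evalTerm : ∀ {q v n} → (Fin q → Fin n → Fin n) → (Fin v → Fin n) → Term q v → Fin n
evalTerm F ρ (x , fs) = foldr (λ f w → F f w) (ρ x) fs

evalGF : ∀ {k p q c v n} → Tuple k n → (Fin p → VSet n) → (Fin q → Fin n → Fin n) →
         (Fin c → Fin n → ℕ) → (Fin v → Fin n) → GF k p q c v → Bool
evalGF A P F γ ρ ⊤ᴳ = true
evalGF A P F γ ρ (¬ᴳ φ) = not (evalGF A P F γ ρ φ)
evalGF A P F γ ρ (φ ∧ᴳ ψ) = evalGF A P F γ ρ φ ∧ evalGF A P F γ ρ ψ
evalGF A P F γ ρ (φ ∨ᴳ ψ) = evalGF A P F γ ρ φ ∨ evalGF A P F γ ρ ψ
evalGF A P F γ ρ (t ≐ t') = evalTerm F ρ t =ᶠ evalTerm F ρ t'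
evalGF A P F γ ρ (Xᴳ i t) = A i (evalTerm F ρ t)
evalGF A P F γ ρ (Pᴳ a t) = P a (evalTerm F ρ t)
evalGF A P F γ ρ (γᴳ g t m _) = m ≤ᵇ γ g (evalTerm F ρ t)
evalGF A P F γ ρ (#ᴳ θ m) = m ≤ᵇ count (evalLF A P γ θ)

sat : ∀ {n k} {G : Graph n} {σ : Sig k} → Interp G σ → Tuple k n → Sentence σ → Bool
sat {σ = σ} ℐ A φ =
  evalGF A (pred ℐ) (fun ℐ) (evalCounters A (pred ℐ) (fun ℐ) (counters σ)) (λ ()) φ

TupleIn : ∀ {k n} → VSet n → Tuple k n → Set
TupleIn S A = ∀ i v → A i v ≡ true → S v ≡ true

EquivLR : ∀ {n k} {G : Graph n} {σ : Sig k} (L R : Subgraph G) →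
          Interp G σ → Sentence σ → Tuple k n → Tuple k n → Set
EquivLR {k = k} L R ℐ φ A A' =
  ∀ (B : Tuple k _) → TupleIn (λ v → vert R v ∧ not (vert L v)) B →
  sat ℐ (A ∪ᵀ B) φ ≡ sat ℐ (A' ∪ᵀ B) φ

-- ≡_(L,R) (on I-tuples of subsets of V(L)) has at most N equivalence classes:
-- there are at most N representatives covering all classes.
ClassesAtMost : ∀ {n k} {G : Graph n} {σ : Sig k} (L R : Subgraph G) →
                Interp G σ → Sentence σ → ℕ → Set
ClassesAtMost {n} {k} L R ℐ φ N =
  Σ ℕ λ m → m ≤ N × Σ (Fin m → Tuple k n) λ reps →
    (∀ j → TupleIn (vert L) (reps j)) ×
    (∀ (A : Tuple k n) → TupleIn (vert L) A → ∃ λ j → EquivLR L R ℐ φ A (reps j))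

interSize : ∀ {n} {G : Graph n} → Subgraph G → Subgraph G → ℕ
interSize L R = count (λ v → vert L v ∧ vert R v)

-- Let S = V(L ∩ R), let q be the number of function symbols and c the number of counters, and
-- let W be the set of vertices reachable from S by at most c applications of function symbols,
-- so |W| ≤ (q+1)^c |S|.  Call a vertex interior if it lies in L but neither in R nor in W.
-- Function symbols move along edges and the j-th counter of a vertex only looks at the earlier
-- counters of its preimages, so the counters of an interior vertex never see a tuple
-- B ⊆ V(R) ∖ V(L), and interior vertices only feed counters of vertices in W.  All thresholds
-- in σ and φ are at most some M, so counter values and #-counts matter only up to M.  Hence the
-- (L,R)-class of A is determined by its profile: A on W, the number (truncated at M) of interior
-- vertices feeding each counter of each vertex of W, and the number (truncated at M) of interior
-- vertices satisfying each of the a #-atoms of φ.  There are at most (2^k (M+1)^c)^|W| (M+1)^a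
-- profiles.

module Submission where

open import Defs
open import Data.Nat using (ℕ; _*_; _^_)
open import Data.Product using (∃)

open import Data.Bool using (Bool; true; false; _∧_; _∨_; not; if_then_else_; T)
open import Data.Unit using (⊤)
open import Data.Bool.Properties using (not-injective; ∨-identityʳ; ∧-zeroʳ)
open import Function.Bundles using (mk⇔)
open import Data.Fin using (Fin; zero; suc; toℕ; fromℕ<; combine; funToFin; finToFun; _≟_)
open import Data.Fin.Properties using (toℕ-fromℕ<; combine-injective; finToFun-funToFin; any?)
open import Data.List using (List; []; _∷_; _++_; map; allFin; concatMap; filter; length; lookup)
open import Data.List.Properties using (map-cong; length-++; length-map; length-tabulate)
open import Data.List.Membership.Propositional using (_∈_; _∉_)
open import Data.List.Membership.Propositional.Properties
  using (∈-++⁺ˡ; ∈-++⁺ʳ; ∈-map⁺; ∈-allFin; ∈-filter⁺; ∈-concatMap⁺)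
open import Data.List.Relation.Unary.Any as Any using (here; there)
open import Data.List.Relation.Unary.Any.Properties using (lookup-index)
open import Data.Nat using (suc; zero; _+_; _≤_; _≤ᵇ_; _⊓_; _⊔_; z≤n; s≤s)
open import Data.Nat.ListAction using (sum)
open import Data.Nat.Properties hiding (_≟_)
open import Data.Product using (_×_; _,_; proj₁; proj₂)
open import Data.Sum using (_⊎_; inj₁; inj₂)
open import Function using (_∘_)
open import Relation.Binary.PropositionalEquality
open import Relation.Nullary using (Dec; yes; no; does; contradiction)
open import Relation.Nullary.Decidable using (T?; does-⇔)

private
  ifb : Bool → ℕ
  ifb b = if b then 1 else 0

-- Counting and truncation at a threshold

count-cong : ∀ {n} {P Q : Fin n → Bool} → (∀ u → P u ≡ Q u) → count P ≡ count Q
count-cong {n} P≗Q = cong sum (map-cong (cong ifb ∘ P≗Q) (allFin n))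

count-∧-cong : ∀ {n} (H : Fin n → Bool) {P Q : Fin n → Bool} → (∀ u → H u ≡ true → P u ≡ Q u) →
  count (λ u → H u ∧ P u) ≡ count (λ u → H u ∧ Q u)
count-∧-cong H {P} {Q} P≗Q = count-cong pointwise
  where
  pointwise : ∀ u → (H u ∧ P u) ≡ (H u ∧ Q u)
  pointwise u with H u in Hu
  ... | true = P≗Q u Hu
  ... | false = refl

count-split : ∀ {n} (Z P : Fin n → Bool) →
  count P ≡ count (λ u → Z u ∧ P u) + count (λ u → not (Z u) ∧ P u)
count-split {n} Z P = go (allFin n)
  where
  go : ∀ us → sum (map (ifb ∘ P) us) ≡
              sum (map (λ u → ifb (Z u ∧ P u)) us) + sum (map (λ u → ifb (not (Z u) ∧ P u)) us)
  go [] = refl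
  go (u ∷ us) with Z u | P u
  ... | true  | true  = cong suc (go us)
  ... | true  | false = go us
  ... | false | true  = trans (cong suc (go us)) (sym (+-suc _ _))
  ... | false | false = go us

count-false : ∀ {n} {P : Fin n → Bool} → (∀ u → P u ≡ false) → count P ≡ 0
count-false {n} {P} P≡false = trans (count-cong P≡false) (go (allFin n))
  where
  go : ∀ (us : List (Fin n)) → sum (map (λ _ → 0) us) ≡ 0
  go []       = refl
  go (_ ∷ us) = go us

length-filter≡count : ∀ {n} (P : Fin n → Bool) → length (filter (T? ∘ P) (allFin n)) ≡ count P
length-filter≡count {n} P = go (allFin n)
  where
  go : ∀ us → length (filter (T? ∘ P) us) ≡ sum (map (ifb ∘ P) us)
  go []       = refl
  go (u ∷ us) with P u
  ... | true  = cong suc (go us)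
  ... | false = go us

+-⊓-absorb : ∀ M a y → (a + y) ⊓ M ≡ (a ⊓ M + y) ⊓ M
+-⊓-absorb zero    a       y = trans (⊓-zeroʳ _) (sym (⊓-zeroʳ _))
+-⊓-absorb (suc M) zero    y = refl
+-⊓-absorb (suc M) (suc a) y = cong suc (+-⊓-absorb M a y)

+-⊓-cong : ∀ {M a a'} y → a ⊓ M ≡ a' ⊓ M → (a + y) ⊓ M ≡ (a' + y) ⊓ M
+-⊓-cong {M} {a} {a'} y eq = begin
  (a + y) ⊓ M       ≡⟨ +-⊓-absorb M a y ⟩
  (a ⊓ M + y) ⊓ M   ≡⟨ cong (λ z → (z + y) ⊓ M) eq ⟩
  (a' ⊓ M + y) ⊓ M  ≡⟨ +-⊓-absorb M a' y ⟨
  (a' + y) ⊓ M      ∎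
  where open ≡-Reasoning

≤ᵇ-⊓ : ∀ {m M} x → m ≤ M → (m ≤ᵇ x) ≡ (m ≤ᵇ x ⊓ M)
≤ᵇ-⊓ {m} {M} x m≤M = does-⇔
  (mk⇔ (λ m≤x → ⊓-glb m≤x m≤M) (λ m≤x⊓M → ≤-trans m≤x⊓M (m⊓n≤m x M)))
  (m ≤? x) (m ≤? x ⊓ M)

≤ᵇ-cong-⊓ : ∀ {m M} {x y} → m ≤ M → x ⊓ M ≡ y ⊓ M → (m ≤ᵇ x) ≡ (m ≤ᵇ y)
≤ᵇ-cong-⊓ {m} {x = x} {y} m≤M eq =
  trans (≤ᵇ-⊓ x m≤M) (trans (cong (m ≤ᵇ_) eq) (sym (≤ᵇ-⊓ y m≤M)))

count-⊓-cong : ∀ {n M} (Z : Fin n → Bool) {P Q : Fin n → Bool} →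
  count (λ u → Z u ∧ P u) ⊓ M ≡ count (λ u → Z u ∧ Q u) ⊓ M →
  (∀ u → Z u ≡ false → P u ≡ Q u) → count P ⊓ M ≡ count Q ⊓ M
count-⊓-cong {n} {M} Z {P} {Q} inside outside = begin
  count P ⊓ M                             ≡⟨ cong (_⊓ M) (count-split Z P) ⟩
  (count (on P) + count (off P)) ⊓ M      ≡⟨ cong (λ y → (count (on P) + y) ⊓ M) off-equal ⟩
  (count (on P) + count (off Q)) ⊓ M      ≡⟨ +-⊓-cong _ inside ⟩
  (count (on Q) + count (off Q)) ⊓ M      ≡⟨ cong (_⊓ M) (count-split Z Q) ⟨
  count Q ⊓ M                             ∎
  where
  open ≡-Reasoning
  on off : (Fin n → Bool) → Fin n → Bool
  on  P u = Z u ∧ P u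
  off P u = not (Z u) ∧ P u
  off-equal : count (off P) ≡ count (off Q)
  off-equal = count-∧-cong (not ∘ Z) (λ u e → outside u (not-injective e))

-- Thresholds and evaluation of counters

thresholdᴸ : ∀ {k p c} → LF k p c → ℕ
thresholdᴸ ⊤ᴸ          = 0
thresholdᴸ (¬ᴸ θ)      = thresholdᴸ θ
thresholdᴸ (θ ∧ᴸ θ')   = thresholdᴸ θ ⊔ thresholdᴸ θ'
thresholdᴸ (θ ∨ᴸ θ')   = thresholdᴸ θ ⊔ thresholdᴸ θ'
thresholdᴸ (Xᴸ i)      = 0
thresholdᴸ (Pᴸ a)      = 0
thresholdᴸ (γᴸ g m _)  = m

thresholdᶜ : ∀ {k p q c} → Counters k p q c → ℕ
thresholdᶜ []             = 0
thresholdᶜ (cs ▷ (f , θ)) = thresholdᶜ cs ⊔ thresholdᴸ θ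

thresholdᴳ : ∀ {k p q c v} → GF k p q c v → ℕ
thresholdᴳ ⊤ᴳ            = 0
thresholdᴳ (¬ᴳ φ)        = thresholdᴳ φ
thresholdᴳ (φ ∧ᴳ ψ)      = thresholdᴳ φ ⊔ thresholdᴳ ψ
thresholdᴳ (φ ∨ᴳ ψ)      = thresholdᴳ φ ⊔ thresholdᴳ ψ
thresholdᴳ (t ≐ t')      = 0
thresholdᴳ (Xᴳ i t)      = 0
thresholdᴳ (Pᴳ a t)      = 0
thresholdᴳ (γᴳ g t m _)  = m
thresholdᴳ (#ᴳ θ m)      = m ⊔ thresholdᴸ θ

#-atoms : ∀ {k p q c v} → GF k p q c v → List (LF k p c)
#-atoms ⊤ᴳ           = []
#-atoms (¬ᴳ φ)       = #-atoms φ
#-atoms (φ ∧ᴳ ψ)     = #-atoms φ ++ #-atoms ψ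
#-atoms (φ ∨ᴳ ψ)     = #-atoms φ ++ #-atoms ψ
#-atoms (t ≐ t')     = []
#-atoms (Xᴳ i t)     = []
#-atoms (Pᴳ a t)     = []
#-atoms (γᴳ g t m _) = []
#-atoms (#ᴳ θ m)     = θ ∷ []

_≈ᵀ_ : ∀ {k n} → Tuple k n → Tuple k n → Set
A ≈ᵀ A' = ∀ i v → A i v ≡ A' i v

module Evaluation {k p q n : ℕ} (P : Fin p → VSet n) (F : Fin q → Fin n → Fin n) where

  E : ∀ {j} → Tuple k n → Counters k p q j → Fin j → Fin n → ℕ
  E X = evalCounters X P F

  feeds : ∀ {j} → Tuple k n → Counters k p q j → Fin q × LF k p j → Fin n → Fin n → Bool
  feeds X ds (f , θ) v u = not (u =ᶠ v) ∧ ((F f u =ᶠ v) ∧ evalLF X P (E X ds) θ u)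

  feeds-cong : ∀ {j X Y} {ds : Counters k p q j} {f θ v} u →
    (u ≢ v → F f u ≡ v → evalLF X P (E X ds) θ u ≡ evalLF Y P (E Y ds) θ u) →
    feeds X ds (f , θ) v u ≡ feeds Y ds (f , θ) v u
  feeds-cong {f = f} {v = v} u pred-eq with u ≟ v | F f u ≟ v
  ... | yes _   | _       = refl
  ... | no  _   | no  _   = refl
  ... | no  u≢v | yes fu≡v = pred-eq u≢v fu≡v

  contribution : ∀ {j} → (Fin n → Bool) → Tuple k n → Counters k p q j → Fin j → Fin n → ℕ
  contribution Z X (ds ▷ t) zero    v = count (λ u → Z u ∧ feeds X ds t v u)
  contribution Z X (ds ▷ _) (suc g) v = contribution Z X ds g v

  evalLF-cong-⊓ : ∀ {c} M (θ : LF k p c) {X Y γ γ' u} → thresholdᴸ θ ≤ M →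
    (∀ i → X i u ≡ Y i u) → (∀ g → γ g u ⊓ M ≡ γ' g u ⊓ M) →
    evalLF X P γ θ u ≡ evalLF Y P γ' θ u
  evalLF-cong-⊓ M ⊤ᴸ         θ≤M X≈Y γ≈γ' = refl
  evalLF-cong-⊓ M (¬ᴸ θ)     θ≤M X≈Y γ≈γ' = cong not (evalLF-cong-⊓ M θ θ≤M X≈Y γ≈γ')
  evalLF-cong-⊓ M (θ ∧ᴸ θ')  θ≤M X≈Y γ≈γ' =
    cong₂ _∧_ (evalLF-cong-⊓ M θ  (m⊔n≤o⇒m≤o _ _ θ≤M) X≈Y γ≈γ')
              (evalLF-cong-⊓ M θ' (m⊔n≤o⇒n≤o _ _ θ≤M) X≈Y γ≈γ')
  evalLF-cong-⊓ M (θ ∨ᴸ θ')  θ≤M X≈Y γ≈γ' =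
    cong₂ _∨_ (evalLF-cong-⊓ M θ  (m⊔n≤o⇒m≤o _ _ θ≤M) X≈Y γ≈γ')
              (evalLF-cong-⊓ M θ' (m⊔n≤o⇒n≤o _ _ θ≤M) X≈Y γ≈γ')
  evalLF-cong-⊓ M (Xᴸ i)     θ≤M X≈Y γ≈γ' = X≈Y i
  evalLF-cong-⊓ M (Pᴸ a)     θ≤M X≈Y γ≈γ' = refl
  evalLF-cong-⊓ M (γᴸ g m _) θ≤M X≈Y γ≈γ' = ≤ᵇ-cong-⊓ θ≤M (γ≈γ' g)

  evalLF-cong : ∀ {c} (θ : LF k p c) {X Y γ γ' u} →
    (∀ i → X i u ≡ Y i u) → (∀ g → γ g u ≡ γ' g u) → evalLF X P γ θ u ≡ evalLF Y P γ' θ u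
  evalLF-cong θ X≈Y γ≡γ' = evalLF-cong-⊓ (thresholdᴸ θ) θ ≤-refl X≈Y (cong (_⊓ _) ∘ γ≡γ')

  module _ {X Y : Tuple k n} (D : ℕ → Fin n → Set)
           (D-antitone : ∀ {j u} → D (suc j) u → D j u)
           (D-closed : ∀ {j} f {u v} → D (suc j) v → F f u ≡ v → u ≢ v → D j u)
           (agree : ∀ {j u} → D j u → ∀ i → X i u ≡ Y i u) where

    evalCounters-local : ∀ {j} (ds : Counters k p q j) g {v} → D j v → E X ds g v ≡ E Y ds g v
    evalCounters-local (ds ▷ (f , θ)) zero {v} v∈D =
      count-cong λ u → feeds-cong {X = X} {Y} {ds} {f} {θ} {v} u λ u≢v fu≡v →
        let u∈D = D-closed f v∈D fu≡v u≢v in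
        evalLF-cong θ {u = u} (agree u∈D) (λ g → evalCounters-local ds g u∈D)
    evalCounters-local (ds ▷ _)       (suc g) v∈D = evalCounters-local ds g (D-antitone v∈D)

  evalCounters-cong : ∀ {X Y j} → X ≈ᵀ Y → (ds : Counters k p q j) → ∀ g v → E X ds g v ≡ E Y ds g v
  evalCounters-cong X≈Y ds g v =
    evalCounters-local (λ _ _ → ⊤) _ (λ _ _ _ _ → _) (λ {_} {u} _ i → X≈Y i u) ds g _

  contribution-cong : ∀ Z {X Y} → X ≈ᵀ Y → ∀ {j} (ds : Counters k p q j) g v →
    contribution Z X ds g v ≡ contribution Z Y ds g v
  contribution-cong Z {X} {Y} X≈Y (ds ▷ (f , θ)) zero v =
    count-∧-cong Z λ u _ → feeds-cong {X = X} {Y} {ds} {f} {θ} {v} u λ _ _ →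
      evalLF-cong θ (λ i → X≈Y i u) (λ g → evalCounters-cong X≈Y ds g u)
  contribution-cong Z X≈Y (ds ▷ _) (suc g) v = contribution-cong Z X≈Y ds g v

  module _ (Z : Fin n → Bool) (M : ℕ) {X Y : Tuple k n}
           (agree : ∀ u → Z u ≡ false → ∀ i → X i u ≡ Y i u) where

    evalCounters-⊓-outside : ∀ {j} (ds : Counters k p q j) → thresholdᶜ ds ≤ M →
      (∀ g v → Z v ≡ false → contribution Z X ds g v ⊓ M ≡ contribution Z Y ds g v ⊓ M) →
      ∀ g v → Z v ≡ false → E X ds g v ⊓ M ≡ E Y ds g v ⊓ M
    evalCounters-⊓-outside (ds ▷ (f , θ)) ds≤M contrib≈ zero v v∉Z =
      count-⊓-cong Z (contrib≈ zero v v∉Z) λ u u∉Z →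
        feeds-cong {X = X} {Y} {ds} {f} {θ} {v} u λ _ _ →
          evalLF-cong-⊓ M θ {u = u} (m⊔n≤o⇒n≤o _ _ ds≤M) (agree u u∉Z)
            (λ g → evalCounters-⊓-outside ds (m⊔n≤o⇒m≤o _ _ ds≤M) (contrib≈ ∘ suc) g u u∉Z)
    evalCounters-⊓-outside (ds ▷ (f , θ)) ds≤M contrib≈ (suc g) =
      evalCounters-⊓-outside ds (m⊔n≤o⇒m≤o _ _ ds≤M) (contrib≈ ∘ suc) g

    module _ {c} {γ γ' : Fin c → Fin n → ℕ}
             (γ≈γ' : ∀ g v → Z v ≡ false → γ g v ⊓ M ≡ γ' g v ⊓ M) where

      evalGF-⊓-outside : (ρ : Fin 0 → Fin n) (ψ : GF k p q c 0) → thresholdᴳ ψ ≤ M →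
        (∀ θ → θ ∈ #-atoms ψ →
           count (λ u → Z u ∧ evalLF X P γ θ u) ⊓ M ≡ count (λ u → Z u ∧ evalLF Y P γ' θ u) ⊓ M) →
        evalGF X P F γ ρ ψ ≡ evalGF Y P F γ' ρ ψ
      evalGF-⊓-outside ρ ⊤ᴳ       ψ≤M atoms≈ = refl
      evalGF-⊓-outside ρ (¬ᴳ ψ)   ψ≤M atoms≈ = cong not (evalGF-⊓-outside ρ ψ ψ≤M atoms≈)
      evalGF-⊓-outside ρ (ψ ∧ᴳ ψ') ψ≤M atoms≈ =
        cong₂ _∧_ (evalGF-⊓-outside ρ ψ  (m⊔n≤o⇒m≤o _ _ ψ≤M) (λ θ → atoms≈ θ ∘ ∈-++⁺ˡ))
                  (evalGF-⊓-outside ρ ψ' (m⊔n≤o⇒n≤o _ _ ψ≤M) (λ θ → atoms≈ θ ∘ ∈-++⁺ʳ (#-atoms ψ)))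
      evalGF-⊓-outside ρ (ψ ∨ᴳ ψ') ψ≤M atoms≈ =
        cong₂ _∨_ (evalGF-⊓-outside ρ ψ  (m⊔n≤o⇒m≤o _ _ ψ≤M) (λ θ → atoms≈ θ ∘ ∈-++⁺ˡ))
                  (evalGF-⊓-outside ρ ψ' (m⊔n≤o⇒n≤o _ _ ψ≤M) (λ θ → atoms≈ θ ∘ ∈-++⁺ʳ (#-atoms ψ)))
      evalGF-⊓-outside ρ ((() , _) ≐ _)   ψ≤M atoms≈
      evalGF-⊓-outside ρ (Xᴳ i (() , _))  ψ≤M atoms≈
      evalGF-⊓-outside ρ (Pᴳ a (() , _))  ψ≤M atoms≈
      evalGF-⊓-outside ρ (γᴳ g (() , _) m _) ψ≤M atoms≈
      evalGF-⊓-outside ρ (#ᴳ θ m) ψ≤M atoms≈ =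
        ≤ᵇ-cong-⊓ {m} (m⊔n≤o⇒m≤o _ _ ψ≤M)
          (count-⊓-cong Z {evalLF X P γ θ} (atoms≈ θ (here refl)) λ u u∉Z →
            evalLF-cong-⊓ M θ (m⊔n≤o⇒n≤o _ _ ψ≤M) (agree u u∉Z) (λ g → γ≈γ' g u u∉Z))

-- Encoding tuples and counting classes

funToFin-cong : ∀ {m b} {f g : Fin m → Fin b} → (∀ x → f x ≡ g x) → funToFin f ≡ funToFin g
funToFin-cong {zero}  f≗g = refl
funToFin-cong {suc m} f≗g = cong₂ combine (f≗g zero) (funToFin-cong (f≗g ∘ suc))

funToFin-injective : ∀ {m b} {f g : Fin m → Fin b} → funToFin f ≡ funToFin g → ∀ x → f x ≡ g x
funToFin-injective {f = f} {g} eq x = begin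
  f x                     ≡⟨ finToFun-funToFin f x ⟨
  finToFun (funToFin f) x ≡⟨ cong (λ t → finToFun t x) eq ⟩
  finToFun (funToFin g) x ≡⟨ finToFun-funToFin g x ⟩
  g x                     ∎
  where open ≡-Reasoning

toFin₂ : Bool → Fin 2
toFin₂ false = zero
toFin₂ true  = suc zero

fromFin₂ : Fin 2 → Bool
fromFin₂ zero    = false
fromFin₂ (suc _) = true

fromFin₂-toFin₂ : ∀ b → fromFin₂ (toFin₂ b) ≡ b
fromFin₂-toFin₂ false = refl
fromFin₂-toFin₂ true  = refl

toFin₂-injective : ∀ {a b} → toFin₂ a ≡ toFin₂ b → a ≡ b
toFin₂-injective {a} {b} eq =
  trans (sym (fromFin₂-toFin₂ a)) (trans (cong fromFin₂ eq) (fromFin₂-toFin₂ b))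

tupleIndex : ∀ {k n} → Tuple k n → Fin ((2 ^ n) ^ k)
tupleIndex A = funToFin (λ i → funToFin (toFin₂ ∘ A i))

tupleAt : ∀ {k n} → Fin ((2 ^ n) ^ k) → Tuple k n
tupleAt t i v = fromFin₂ (finToFun (finToFun t i) v)

tupleAt-tupleIndex : ∀ {k n} (A : Tuple k n) → tupleAt (tupleIndex A) ≈ᵀ A
tupleAt-tupleIndex A i v = begin
  fromFin₂ (finToFun (finToFun (tupleIndex A) i) v)       ≡⟨ cong (λ t → fromFin₂ (finToFun t v))
                                                               (finToFun-funToFin _ i) ⟩
  fromFin₂ (finToFun (funToFin (toFin₂ ∘ A i)) v)         ≡⟨ cong fromFin₂ (finToFun-funToFin _ v) ⟩
  fromFin₂ (toFin₂ (A i v))                                ≡⟨ fromFin₂-toFin₂ (A i v) ⟩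
  A i v                                                    ∎
  where open ≡-Reasoning

restrict : ∀ {k n} → VSet n → Tuple k n → Tuple k n
restrict S A i v = A i v ∧ S v

restrict-in : ∀ {k n} (S : VSet n) (A : Tuple k n) → TupleIn S (restrict S A)
restrict-in S A i v with A i v | S v
... | true | true = λ _ → refl

restrict-≈ : ∀ {k n} {S : VSet n} {A : Tuple k n} → TupleIn S A → restrict S A ≈ᵀ A
restrict-≈ {S = S} {A} A∈S i v with A i v in e
... | true  = A∈S i v e
... | false = refl

outside-false : ∀ {k n} {S : VSet n} {X : Tuple k n} → TupleIn S X →
  ∀ {u} → S u ≡ false → ∀ i → X i u ≡ false
outside-false {X = X} X⊆S {u} u∉S i with X i u in e
... | true  = contradiction (trans (sym (X⊆S i u e)) u∉S) λ ()
... | false = refl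

module _ {n k} {G : Graph n} {σ : Sig k} (L R : Subgraph G) (ℐ : Interp G σ) (φ : Sentence σ) where

  classesAtMost-mono : ∀ {N N'} → N ≤ N' → ClassesAtMost L R ℐ φ N → ClassesAtMost L R ℐ φ N'
  classesAtMost-mono N≤N' (m , m≤N , rest) = m , ≤-trans m≤N N≤N' , rest

  classesAtMost-byInvariant : ∀ {N} (κ : Tuple k n → Fin N) →
    (∀ {A A'} → A ≈ᵀ A' → κ A ≡ κ A') →
    (∀ {A A'} → TupleIn (vert L) A → TupleIn (vert L) A' → κ A ≡ κ A' → EquivLR L R ℐ φ A A') →
    ClassesAtMost L R ℐ φ N
  classesAtMost-byInvariant {N} κ κ-cong κ-separates =
    N , ≤-refl , rep , (λ j → pick-in-L (search j)) , cover
    where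
    candidate : Fin ((2 ^ n) ^ k) → Tuple k n
    candidate t = restrict (vert L) (tupleAt t)

    Realised : Fin N → Set
    Realised j = ∃ λ t → κ (candidate t) ≡ j

    search : ∀ j → Dec (Realised j)
    search j = any? (λ t → κ (candidate t) ≟ j)

    pick : ∀ {j} → Dec (Realised j) → Tuple k n
    pick (yes (t , _)) = candidate t
    pick (no _)        = λ _ _ → false

    pick-in-L : ∀ {j} (d : Dec (Realised j)) → TupleIn (vert L) (pick d)
    pick-in-L (yes (t , _)) = restrict-in (vert L) (tupleAt t)
    pick-in-L (no _)        = λ _ _ ()

    pick-realises : ∀ {j} (d : Dec (Realised j)) → Realised j → κ (pick d) ≡ j
    pick-realises (yes (_ , κt≡j)) _ = κt≡j
    pick-realises (no ¬realised)   r = contradiction r ¬realised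

    rep : Fin N → Tuple k n
    rep j = pick (search j)

    cover : ∀ A → TupleIn (vert L) A → ∃ λ j → EquivLR L R ℐ φ A (rep j)
    cover A A∈L =
      κ A , κ-separates A∈L (pick-in-L (search (κ A))) (sym (pick-realises (search (κ A)) realised))
      where
      realised : Realised (κ A)
      realised = tupleIndex A , κ-cong λ i v →
        trans (restrict-≈ (λ i v → A∈L i v ∘ trans (sym (tupleAt-tupleIndex A i v))) i v)
              (tupleAt-tupleIndex A i v)

-- The separator argument

module Separation {n k} {G : Graph n} {σ : Sig k} (L R : Subgraph G) (L∪R : IsUnion G L R)
                  (ℐ : Interp G σ) (φ : Sentence σ) where

  open Evaluation {k = k} (pred ℐ) (fun ℐ)
  open import Data.List.Membership.DecPropositional (_≟_ {n}) using (_∈?_)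

  q c : ℕ
  q = nfun σ
  c = ncnt σ

  cs : Counters k (npred σ) q c
  cs = counters σ

  fun-adjacent : ∀ f {u v} → fun ℐ f u ≡ v → u ≢ v → adj G u v ≡ true
  fun-adjacent f {u} fu≡v u≢v with fun-ok ℐ f u
  ... | inj₁ fu≡u = contradiction (trans (sym fu≡u) fu≡v) u≢v
  ... | inj₂ adj-u = subst (λ v → adj G u v ≡ true) fu≡v adj-u

  adj-∉R⇒∈L : ∀ {u v} → adj G u v ≡ true → vert R v ≡ false → vert L u ≡ true
  adj-∉R⇒∈L {u} {v} adj-uv v∉R with edge L u v in eL | edge R u v in eR
  ... | true  | _     = proj₁ (edge-ends L u v eL)
  ... | false | true  = contradiction (trans (sym (proj₂ (edge-ends R u v eR))) v∉R) λ ()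
  ... | false | false =
    contradiction (trans (sym adj-uv) (trans (proj₂ L∪R u v) (cong₂ _∨_ eL eR))) λ ()

  neighbourhood : Fin n → List (Fin n)
  neighbourhood w = w ∷ map (λ f → fun ℐ f w) (allFin q)

  -- Listed with repetitions, so that its length is exactly (q+1)^j |V(L ∩ R)|.
  W : ℕ → List (Fin n)
  W zero    = filter (λ v → T? (vert L v ∧ vert R v)) (allFin n)
  W (suc j) = concatMap neighbourhood (W j)

  W-step : ∀ {u} j → u ∈ W j → u ∈ W (suc j)
  W-step _ u∈W = ∈-concatMap⁺ neighbourhood (Any.map (λ { refl → here refl }) u∈W)

  W-image : ∀ {u} j f → u ∈ W j → fun ℐ f u ∈ W (suc j)
  W-image _ f u∈W =
    ∈-concatMap⁺ neighbourhood (Any.map (λ { refl → there (∈-map⁺ _ (∈-allFin f)) }) u∈W)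

  W-mono : ∀ {u} j j' → j ≤ j' → u ∈ W j → u ∈ W j'
  W-mono j zero     z≤n  u∈W = u∈W
  W-mono j (suc j') j≤j' u∈W with m≤n⇒m<n∨m≡n j≤j'
  ... | inj₁ (s≤s j≤j'') = W-step j' (W-mono j j' j≤j'' u∈W)
  ... | inj₂ refl        = u∈W

  L∩R⊆W : ∀ {u} j → vert L u ≡ true → vert R u ≡ true → u ∈ W j
  L∩R⊆W {u} j u∈L u∈R = W-mono 0 j z≤n
    (∈-filter⁺ (λ v → T? (vert L v ∧ vert R v)) (∈-allFin u) (subst T (sym (cong₂ _∧_ u∈L u∈R)) _))

  length-W : ∀ j → length (W j) ≡ suc q ^ j * interSize L R
  length-W zero    = trans (length-filter≡count (λ v → vert L v ∧ vert R v)) (sym (+-identityʳ _))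
  length-W (suc j) = begin
    length (W (suc j))               ≡⟨ length-concatMap (W j) ⟩
    suc q * length (W j)             ≡⟨ cong (suc q *_) (length-W j) ⟩
    suc q * (suc q ^ j * interSize L R) ≡⟨ *-assoc (suc q) (suc q ^ j) (interSize L R) ⟨
    suc q ^ suc j * interSize L R    ∎
    where
    open ≡-Reasoning
    length-concatMap : ∀ ws → length (concatMap neighbourhood ws) ≡ suc q * length ws
    length-concatMap []       = sym (*-zeroʳ (suc q))
    length-concatMap (w ∷ ws) = begin
      suc (length (images ++ _))    ≡⟨ cong suc (length-++ images) ⟩
      suc (length images + _)       ≡⟨ cong₂ (λ x y → suc (x + y)) length-images (length-concatMap ws) ⟩
      suc q + suc q * length ws     ≡⟨ *-suc (suc q) (length ws) ⟨
      suc q * suc (length ws)       ∎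
      where
      images = map (λ f → fun ℐ f w) (allFin q)
      length-images : length images ≡ q
      length-images = trans (length-map _ (allFin q)) (length-tabulate {n = q} (λ f → f))

  R∖L : VSet n
  R∖L v = vert R v ∧ not (vert L v)

  ∪ᵀ-on-L : ∀ {A B : Tuple k n} → TupleIn R∖L B → ∀ {u} → vert L u ≡ true → ∀ i → (A ∪ᵀ B) i u ≡ A i u
  ∪ᵀ-on-L {A} B⊆R∖L {u} u∈L i = trans (cong (A i u ∨_) (outside-false B⊆R∖L u∉R∖L i)) (∨-identityʳ _)
    where
    u∉R∖L : R∖L u ≡ false
    u∉R∖L = trans (cong (λ b → vert R u ∧ not b) u∈L) (∧-zeroʳ _)

  -- The first j counters at a vertex of Deep j only look at vertices of L ∖ R (evalCounters-local).
  record Deep (j : ℕ) (u : Fin n) : Set where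
    constructor deep
    field
      in-L  : vert L u ≡ true
      out-R : vert R u ≡ false
      out-W : u ∉ W j

  Deep-weaken : ∀ {j j' u} → j ≤ j' → Deep j' u → Deep j u
  Deep-weaken {j} {j'} j≤j' (deep u∈L u∉R u∉W) = deep u∈L u∉R (u∉W ∘ W-mono j j' j≤j')

  Deep-antitone : ∀ {j u} → Deep (suc j) u → Deep j u
  Deep-antitone = Deep-weaken (n≤1+n _)

  Deep-closed : ∀ {j} f {u v} → Deep (suc j) v → fun ℐ f u ≡ v → u ≢ v → Deep j u
  Deep-closed {j} f {u} (deep _ v∉R v∉W) fu≡v u≢v = deep u∈L u∉R u∉W
    where
    u∈L : vert L u ≡ true
    u∈L = adj-∉R⇒∈L (fun-adjacent f fu≡v u≢v) v∉R
    u∉W : u ∉ W j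
    u∉W u∈W = v∉W (subst (_∈ W (suc j)) fu≡v (W-image j f u∈W))
    u∉R : vert R u ≡ false
    u∉R with vert R u in e
    ... | true  = contradiction (L∩R⊆W j u∈L e) u∉W
    ... | false = refl

  interior : Fin n → Bool
  interior u = (vert L u ∧ not (vert R u)) ∧ not (does (u ∈? W c))

  interior-true : ∀ {u} → interior u ≡ true → Deep c u
  interior-true {u} with vert L u in eL | vert R u in eR | u ∈? W c
  ... | true  | false | no u∉W = λ _ → deep eL eR u∉W
  ... | true  | true  | _      = λ ()
  ... | false | _     | _      = λ ()
  ... | true  | false | yes _  = λ ()

  interior-false : ∀ {u} → interior u ≡ false → u ∈ W c ⊎ vert L u ≡ false
  interior-false {u} with vert L u in eL | vert R u in eR | u ∈? W c
  ... | _     | _     | yes u∈W = λ _ → inj₁ u∈W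
  ... | true  | true  | no _    = λ _ → inj₁ (L∩R⊆W c eL eR)
  ... | true  | false | no _    = λ ()
  ... | false | _     | no _    = λ _ → inj₂ refl

  interiorCount : Tuple k n → LF k (npred σ) c → ℕ
  interiorCount X θ = count (λ u → interior u ∧ evalLF X (pred ℐ) (E X cs) θ u)

  module _ {A B : Tuple k n} (B⊆R∖L : TupleIn R∖L B) where

    evalLF-interior : ∀ {u} → interior u ≡ true → ∀ {j} (ds : Counters k (npred σ) q j) → j ≤ c →
      (θ : LF k (npred σ) j) →
      evalLF (A ∪ᵀ B) (pred ℐ) (E (A ∪ᵀ B) ds) θ u ≡ evalLF A (pred ℐ) (E A ds) θ u
    evalLF-interior u∈Z ds j≤c θ =
      evalLF-cong θ (∪ᵀ-on-L {A} B⊆R∖L u∈L) λ g →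
        evalCounters-local Deep Deep-antitone Deep-closed (∪ᵀ-on-L {A} B⊆R∖L ∘ Deep.in-L)
          ds g (Deep-weaken j≤c (interior-true u∈Z))
      where u∈L = Deep.in-L (interior-true u∈Z)

    contribution-interior : ∀ {j} (ds : Counters k (npred σ) q j) → j ≤ c → ∀ g v →
      contribution interior (A ∪ᵀ B) ds g v ≡ contribution interior A ds g v
    contribution-interior (ds ▷ (f , θ)) j≤c zero v =
      count-∧-cong interior λ u u∈Z → feeds-cong {X = A ∪ᵀ B} {A} {ds} {f} {θ} {v} u λ _ _ →
        evalLF-interior u∈Z ds (≤-trans (n≤1+n _) j≤c) θ
    contribution-interior (ds ▷ _) j≤c (suc g) v =
      contribution-interior ds (≤-trans (n≤1+n _) j≤c) g v

    interiorCount-∪ᵀ : ∀ θ → interiorCount (A ∪ᵀ B) θ ≡ interiorCount A θ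
    interiorCount-∪ᵀ θ = count-∧-cong interior λ u u∈Z → evalLF-interior u∈Z cs ≤-refl θ

  contribution-outside-L : ∀ X {j} (ds : Counters k (npred σ) q j) g {v} → vert L v ≡ false →
    contribution interior X ds g v ≡ 0
  contribution-outside-L X (ds ▷ (f , θ)) zero {v} v∉L = count-false pointwise
    where
    pointwise : ∀ u → (interior u ∧ feeds X ds (f , θ) v u) ≡ false
    pointwise u with interior u in e | u ≟ v | fun ℐ f u ≟ v
    ... | false | _       | _        = refl
    ... | true  | yes _   | _        = refl
    ... | true  | no _    | no _     = refl
    ... | true  | no u≢v  | yes fu≡v =
      contradiction (trans (sym v∈L) v∉L) λ ()
      where
      v∈L = adj-∉R⇒∈L (trans (adj-sym G v u) (fun-adjacent f fu≡v u≢v))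
                       (Deep.out-R (interior-true e))
  contribution-outside-L X (ds ▷ _) (suc g) v∉L = contribution-outside-L X ds g v∉L

  M : ℕ
  M = thresholdᶜ cs ⊔ thresholdᴳ φ

  record SameProfile (A A' : Tuple k n) : Set where
    field
      on-W          : ∀ {w} → w ∈ W c → ∀ i → A i w ≡ A' i w
      contributions : ∀ {w} → w ∈ W c → ∀ g →
                      contribution interior A cs g w ⊓ M ≡ contribution interior A' cs g w ⊓ M
      #-atom-counts : ∀ {θ} → θ ∈ #-atoms φ → interiorCount A θ ⊓ M ≡ interiorCount A' θ ⊓ M

  sameProfile⇒equiv : ∀ {A A'} → TupleIn (vert L) A → TupleIn (vert L) A' → SameProfile A A' →
    EquivLR L R ℐ φ A A'
  sameProfile⇒equiv {A} {A'} A⊆L A'⊆L same B B⊆R∖L =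
    evalGF-⊓-outside interior M agree counters≈ (λ ()) φ (m≤n⊔m _ _) atoms≈
    where
    open SameProfile same
    open ≡-Reasoning

    agree : ∀ u → interior u ≡ false → ∀ i → (A ∪ᵀ B) i u ≡ (A' ∪ᵀ B) i u
    agree u u∉Z i with interior-false u∉Z
    ... | inj₁ u∈W = cong (_∨ B i u) (on-W u∈W i)
    ... | inj₂ e   = cong (_∨ B i u) (trans (outside-false A⊆L e i) (sym (outside-false A'⊆L e i)))

    contributions≈ : ∀ g v → interior v ≡ false →
      contribution interior (A ∪ᵀ B) cs g v ⊓ M ≡ contribution interior (A' ∪ᵀ B) cs g v ⊓ M
    contributions≈ g v v∉Z with interior-false v∉Z
    ... | inj₁ v∈W = begin
      contribution interior (A ∪ᵀ B) cs g v ⊓ M   ≡⟨ cong (_⊓ M) (drop-B A) ⟩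
      contribution interior A cs g v ⊓ M          ≡⟨ contributions v∈W g ⟩
      contribution interior A' cs g v ⊓ M         ≡⟨ cong (_⊓ M) (drop-B A') ⟨
      contribution interior (A' ∪ᵀ B) cs g v ⊓ M  ∎
      where
      drop-B : ∀ X → contribution interior (X ∪ᵀ B) cs g v ≡ contribution interior X cs g v
      drop-B X = contribution-interior B⊆R∖L cs ≤-refl g v
    ... | inj₂ e   = cong (_⊓ M) (trans (contribution-outside-L (A ∪ᵀ B) cs g e)
                                     (sym (contribution-outside-L (A' ∪ᵀ B) cs g e)))

    counters≈ : ∀ g v → interior v ≡ false → E (A ∪ᵀ B) cs g v ⊓ M ≡ E (A' ∪ᵀ B) cs g v ⊓ M
    counters≈ = evalCounters-⊓-outside interior M agree cs (m≤m⊔n _ _) contributions≈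

    atoms≈ : ∀ θ → θ ∈ #-atoms φ → interiorCount (A ∪ᵀ B) θ ⊓ M ≡ interiorCount (A' ∪ᵀ B) θ ⊓ M
    atoms≈ θ θ∈φ = begin
      interiorCount (A ∪ᵀ B) θ ⊓ M   ≡⟨ cong (_⊓ M) (interiorCount-∪ᵀ B⊆R∖L θ) ⟩
      interiorCount A θ ⊓ M          ≡⟨ #-atom-counts θ∈φ ⟩
      interiorCount A' θ ⊓ M         ≡⟨ cong (_⊓ M) (interiorCount-∪ᵀ B⊆R∖L θ) ⟨
      interiorCount (A' ∪ᵀ B) θ ⊓ M  ∎

  capᶠ : ℕ → Fin (suc M)
  capᶠ x = fromℕ< (s≤s (m⊓n≤n x M))

  capᶠ-injective : ∀ {x y} → capᶠ x ≡ capᶠ y → x ⊓ M ≡ y ⊓ M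
  capᶠ-injective eq = trans (sym (toℕ-fromℕ< _)) (trans (cong toℕ eq) (toℕ-fromℕ< _))

  vertexProfile : Tuple k n → Fin (length (W c)) → Fin (2 ^ k * suc M ^ c)
  vertexProfile A x = combine (funToFin λ i → toFin₂ (A i w))
                              (funToFin λ g → capᶠ (contribution interior A cs g w))
    where w = lookup (W c) x

  atomProfile : Tuple k n → Fin (length (#-atoms φ)) → Fin (suc M)
  atomProfile A y = capᶠ (interiorCount A (lookup (#-atoms φ) y))

  profile : Tuple k n → Fin ((2 ^ k * suc M ^ c) ^ length (W c) * suc M ^ length (#-atoms φ))
  profile A = combine (funToFin (vertexProfile A)) (funToFin (atomProfile A))

  interiorCount-cong : ∀ {A A'} → A ≈ᵀ A' → ∀ θ → interiorCount A θ ≡ interiorCount A' θ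
  interiorCount-cong A≈A' θ = count-cong λ u → cong (interior u ∧_)
    (evalLF-cong θ {u = u} (λ i → A≈A' i u) (λ g → evalCounters-cong A≈A' cs g u))

  profile-cong : ∀ {A A'} → A ≈ᵀ A' → profile A ≡ profile A'
  profile-cong {A} {A'} A≈A' =
    cong₂ combine (funToFin-cong vertexProfile-cong) (funToFin-cong atomProfile-cong)
    where
    vertexProfile-cong : ∀ x → vertexProfile A x ≡ vertexProfile A' x
    vertexProfile-cong x = cong₂ combine
      (funToFin-cong λ i → cong toFin₂ (A≈A' i w))
      (funToFin-cong λ g → cong capᶠ (contribution-cong interior A≈A' cs g w))
      where w = lookup (W c) x

    atomProfile-cong : ∀ y → atomProfile A y ≡ atomProfile A' y
    atomProfile-cong y = cong capᶠ (interiorCount-cong A≈A' (lookup (#-atoms φ) y))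

  profile-injective : ∀ {A A'} → profile A ≡ profile A' → SameProfile A A'
  profile-injective {A} {A'} eq = record
    { on-W          = λ w∈W i → at-index {Q = λ w → A i w ≡ A' i w} w∈W λ x →
        toFin₂-injective (funToFin-injective (proj₁ (same-vertex x)) i)
    ; contributions = λ w∈W g →
        at-index {Q = λ w → contribution interior A cs g w ⊓ M ≡ contribution interior A' cs g w ⊓ M}
          w∈W λ x → capᶠ-injective (funToFin-injective (proj₂ (same-vertex x)) g)
    ; #-atom-counts = λ θ∈φ →
        at-index {Q = λ θ → interiorCount A θ ⊓ M ≡ interiorCount A' θ ⊓ M}
          θ∈φ λ y → capᶠ-injective (funToFin-injective (proj₂ same-parts) y)
    }
    where
    at-index : ∀ {X : Set} {xs : List X} {x} {Q : X → Set} → x ∈ xs → (∀ i → Q (lookup xs i)) → Q x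
    at-index {Q = Q} x∈xs Q-at = subst Q (sym (lookup-index x∈xs)) (Q-at (Any.index x∈xs))

    same-parts : funToFin (vertexProfile A) ≡ funToFin (vertexProfile A') ×
                 funToFin (atomProfile A) ≡ funToFin (atomProfile A')
    same-parts = combine-injective (funToFin (vertexProfile A)) (funToFin (atomProfile A))
                                   (funToFin (vertexProfile A')) (funToFin (atomProfile A')) eq

    same-vertex : ∀ x → let w = lookup (W c) x in
      funToFin (λ i → toFin₂ (A i w)) ≡ funToFin (λ i → toFin₂ (A' i w)) ×
      funToFin (λ g → capᶠ (contribution interior A cs g w)) ≡
      funToFin (λ g → capᶠ (contribution interior A' cs g w))
    same-vertex x = combine-injective _ _ _ _ (funToFin-injective (proj₁ same-parts) x)

  classes : ClassesAtMost L R ℐ φ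
              (suc M ^ length (#-atoms φ) * ((2 ^ k * suc M ^ c) ^ (suc q ^ c)) ^ interSize L R)
  classes = classesAtMost-mono L R ℐ φ (≤-reflexive size)
    (classesAtMost-byInvariant L R ℐ φ profile profile-cong λ A⊆L A'⊆L →
      sameProfile⇒equiv A⊆L A'⊆L ∘ profile-injective)
    where
    a = length (#-atoms φ)
    s = interSize L R
    base = 2 ^ k * suc M ^ c
    open ≡-Reasoning
    size : base ^ length (W c) * suc M ^ a ≡ suc M ^ a * (base ^ (suc q ^ c)) ^ s
    size = begin
      base ^ length (W c) * suc M ^ a     ≡⟨ cong (λ w → base ^ w * suc M ^ a) (length-W c) ⟩
      base ^ (suc q ^ c * s) * suc M ^ a  ≡⟨ cong (_* suc M ^ a) (^-*-assoc base (suc q ^ c) s) ⟨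
      (base ^ (suc q ^ c)) ^ s * suc M ^ a ≡⟨ *-comm _ (suc M ^ a) ⟩
      suc M ^ a * (base ^ (suc q ^ c)) ^ s ∎

corollary18 : (k : ℕ) (σ : Sig k) (φ : Sentence σ) →
    ∃ λ C → ∃ λ c →
      ∀ (n : ℕ) (G : Graph n) (L R : Subgraph G) → IsUnion G L R →
      (ℐ : Interp G σ) → ClassesAtMost L R ℐ φ (C * c ^ interSize L R)
corollary18 k σ φ =
  suc M ^ length (#-atoms φ) , (2 ^ k * suc M ^ ncnt σ) ^ (suc (nfun σ) ^ ncnt σ) ,
  λ n G L R L∪R ℐ → Separation.classes L R L∪R ℐ φ
  where
  M = thresholdᶜ (counters σ) ⊔ thresholdᴳ φ
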